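{- Let $v$ be an indeterminate over $\mathbb{Q}$ and put $$j=\frac{(v^2+13v+49)(v^2+5v+1)^3}{v},\qquad a_4=\frac{3j}{1728-j},\qquad a_6=\frac{2j}{1728-j},$$ $$A(v)=v^4+14v^3+63v^2+70v-7 .$$ Let $g(X)\in\mathbb{Q}(v)[X]$ be the monic polynomial $G(X)/A(v)^3$, where $$\begin{aligned}G(X)={}&A(v)^3X^3+3(v^2+13v+49)(v^2+5v+1)A(v)^2X^2\\&+3(v^2+13v+33)(v^2+13v+49)(v^2+5v+1)^2A(v)\,X\\&+(v^2+13v+49)(v^2+5v+1)^3(v^4+26v^3+219v^2+778v+881).\end{aligned}$$ Then there is a rational function $S\in\mathbb{Q}(v)$, a quotient of two polynomials with integer coefficients, such that $$\mathrm{Resultant}_X\bigl(g(X),\,X^3+a_4X+a_6\bigr)=-3\,j\,v\,A(v)\,S(v)^2 .$$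
   Context: Here $v$ plays the role of a root of the level-$7$ modular equation $(X^2+13X+49)(X^2+5X+1)^3-jX=0$, and $g$ is the factor of degree $3$ of the $7$-division polynomial of $Y^2=X^3+a_4X+a_6$ attached to the corresponding $7$-isogeny. -}

module Defs where

open import Level using (0ℓ)
open import Data.Nat as ℕ using (ℕ; zero; suc; _∸_; _≤?_)
open import Data.Fin using (Fin; toℕ; punchIn) renaming (zero to fzero; suc to fsuc)
open import Data.Integer as ℤ using (ℤ; +_; -[1+_])
open import Data.List using (List; []; _∷_)
open import Data.List.Properties using (≡-dec)
open import Data.List.Relation.Unary.All using (All)
open import Relation.Binary.PropositionalEquality using (_≡_)
open import Relation.Nullary using (¬_; yes; no)
open import Relation.Nullary.Decidable using (_×-dec_)
open import Algebra.Bundles.Raw using (RawRing)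

module _ {c ℓ} (R : RawRing c ℓ) where
  open RawRing R

  altSum : (n : ℕ) → (Fin n → Carrier) → Carrier
  altSum zero    f = 0#
  altSum (suc n) f = f fzero + - altSum n (λ k → f (fsuc k))

  det : (n : ℕ) → (Fin n → Fin n → Carrier) → Carrier
  det zero    M = 1#
  det (suc n) M =
    altSum (suc n) (λ j → M fzero j * det n (λ r k → M (fsuc r) (punchIn j k)))

  -- entry of row i, column k of the block of shifted coefficient rows of a
  -- polynomial of degree m with coefficients a (a d = coefficient of X^d):
  -- the row i is  0 ... 0 a_m a_{m-1} ... a_0 0 ... 0  (i leading zeros)
  shiftCoef : (m : ℕ) → (ℕ → Carrier) → ℕ → ℕ → Carrier
  shiftCoef m a i k with i ℕ.≤? k
  ... | no _ = 0#
  ... | yes _ with (k ∸ i) ℕ.≤? m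
  ...   | yes _ = a (m ∸ (k ∸ i))
  ...   | no _  = 0#

  -- Sylvester matrix of f (degree m, coefficients a) and g (degree n,
  -- coefficients b): n rows of f-coefficients, then m rows of g-coefficients
  sylvester : (m n : ℕ) → (ℕ → Carrier) → (ℕ → Carrier) →
              Fin (m ℕ.+ n) → Fin (m ℕ.+ n) → Carrier
  sylvester m n a b i k with suc (toℕ i) ℕ.≤? n
  ... | yes _ = shiftCoef m a (toℕ i) (toℕ k)
  ... | no _  = shiftCoef n b (toℕ i ∸ n) (toℕ k)

  resultant : (m n : ℕ) → (ℕ → Carrier) → (ℕ → Carrier) → Carrier
  resultant m n a b = det (m ℕ.+ n) (sylvester m n a b)

-- ℤ[v]: polynomials with integer coefficients, lowest degree first

Poly : Set
Poly = List ℤ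

infixl 6 _+ₚ_
infixl 7 _*ₚ_

_+ₚ_ : Poly → Poly → Poly
[]       +ₚ q        = q
(x ∷ p)  +ₚ []       = x ∷ p
(x ∷ p)  +ₚ (y ∷ q)  = (x ℤ.+ y) ∷ (p +ₚ q)

-ₚ_ : Poly → Poly
-ₚ []      = []
-ₚ (x ∷ p) = ℤ.- x ∷ -ₚ p

scaleₚ : ℤ → Poly → Poly
scaleₚ c []      = []
scaleₚ c (x ∷ p) = (c ℤ.* x) ∷ scaleₚ c p

_*ₚ_ : Poly → Poly → Poly
[]      *ₚ q = []
(x ∷ p) *ₚ q = scaleₚ x q +ₚ (+ 0 ∷ (p *ₚ q))

IsZeroPoly : Poly → Set
IsZeroPoly p = All (_≡ + 0) p

-- ℚ(v): quotients of integer polynomials in v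

record Frac : Set where
  constructor _/ₚ_
  field
    num : Poly
    den : Poly
open Frac public

infix 4 _≈f_
infixl 6 _+f_
infixl 7 _*f_ _÷f_
infix 8 -f_

_≈f_ : Frac → Frac → Set
x ≈f y = IsZeroPoly (num x *ₚ den y +ₚ -ₚ (num y *ₚ den x))

_+f_ : Frac → Frac → Frac
x +f y with ≡-dec ℤ._≟_ (den x) (den y)
... | yes _ = (num x +ₚ num y) /ₚ den x
... | no _  = (num x *ₚ den y +ₚ num y *ₚ den x) /ₚ (den x *ₚ den y)

_*f_ : Frac → Frac → Frac
x *f y = (num x *ₚ num y) /ₚ (den x *ₚ den y)

-f_ : Frac → Frac
-f x = (-ₚ num x) /ₚ den x

-- division (only meaningful for y ≠ 0)
_÷f_ : Frac → Frac → Frac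
x ÷f y = (num x *ₚ den y) /ₚ (den x *ₚ num y)

poly : Poly → Frac
poly p = p /ₚ (+ 1 ∷ [])

ℚ⟨v⟩ : RawRing 0ℓ 0ℓ
ℚ⟨v⟩ = record
  { Carrier = Frac
  ; _≈_ = _≈f_
  ; _+_ = _+f_
  ; _*_ = _*f_
  ; -_ = -f_
  ; 0# = poly []
  ; 1# = poly (+ 1 ∷ [])
  }

vₚ : Poly
vₚ = + 0 ∷ + 1 ∷ []

q₁ q₂ q₃ q₄ Aₚ : Poly
q₁ = + 49 ∷ + 13 ∷ + 1 ∷ []
q₂ = + 1 ∷ + 5 ∷ + 1 ∷ []
q₃ = + 33 ∷ + 13 ∷ + 1 ∷ []
q₄ = + 881 ∷ + 778 ∷ + 219 ∷ + 26 ∷ + 1 ∷ []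
Aₚ = -[1+ 6 ] ∷ + 70 ∷ + 63 ∷ + 14 ∷ + 1 ∷ []

constₚ : ℤ → Poly
constₚ c = c ∷ []

j : Frac
j = (q₁ *ₚ q₂ *ₚ q₂ *ₚ q₂) /ₚ vₚ

a₄ a₆ : Frac
a₄ = (poly (constₚ (+ 3)) *f j) ÷f (poly (constₚ (+ 1728)) +f (-f j))
a₆ = (poly (constₚ (+ 2)) *f j) ÷f (poly (constₚ (+ 1728)) +f (-f j))

-- coefficients of G(X) (G d = coefficient of X^d)
Gcoef : ℕ → Poly
Gcoef 0 = q₁ *ₚ q₂ *ₚ q₂ *ₚ q₂ *ₚ q₄
Gcoef 1 = constₚ (+ 3) *ₚ q₃ *ₚ q₁ *ₚ q₂ *ₚ q₂ *ₚ Aₚ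
Gcoef 2 = constₚ (+ 3) *ₚ q₁ *ₚ q₂ *ₚ Aₚ *ₚ Aₚ
Gcoef 3 = Aₚ *ₚ Aₚ *ₚ Aₚ
Gcoef (suc (suc (suc (suc _)))) = []

gcoef : ℕ → Frac
gcoef d = Gcoef d /ₚ (Aₚ *ₚ Aₚ *ₚ Aₚ)

fcoef : ℕ → Frac
fcoef 0 = a₆
fcoef 1 = a₄
fcoef 2 = poly []
fcoef 3 = poly (constₚ (+ 1))
fcoef (suc (suc (suc (suc _)))) = poly []

{-# OPTIONS --safe #-}
-- Write N = (v²+13v+49)(v²+5v+1)³ for the numerator of j.  Since j − 1728 = A(v)²/v, the
-- coefficients a₄ = −3N/A(v)² and a₆ = −2N/A(v)² of f, like those of g = G/A(v)³, have
-- denominator dividing A(v)³.  Hence Res_X(g, f) = Res_X(G, F)/A(v)¹⁸ for F = A(v)³ f, and a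
-- computation in ℤ[v] gives Res_X(G, F) = −3·72⁴·N³·A(v)⁹, so Res_X(g, f) = −3 j v A(v) S²
-- with S = 72² N/A(v)⁵.
--
-- As ℚ(v) is modelled by unnormalised pairs of integer polynomials, the identity is transferred
-- from ℤ by evaluation: at every odd integer t both sides take the value Res_X(G, F)(t)/A(t)¹⁸
-- (cross-multiplied), and A(t) ≡ A(1) = 141 (mod 2) is nonzero.  So the cross difference of
-- the two fractions is an integer polynomial vanishing at all odd integers, hence zero.

module Submission where

open import Defs
open import Data.Product using (Σ; _×_; _,_)
open import Relation.Nullary using (¬_)
open import Data.Integer using (-[1+_])

open import Level using (0ℓ)
open import Function using (id; _∘_; _$_)
open import Algebra.Bundles using (Ring)
open import Algebra.Bundles.Raw using (RawRing)
open import Algebra.Morphism.Structures using (module RingMorphisms)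
open import Data.Empty using (⊥-elim)
open import Data.Fin using (toℕ; punchIn) renaming (zero to fzero; suc to fsuc)
open import Data.Integer as ℤ using (ℤ; +_; 0ℤ; 1ℤ; ∣_∣; _+_; _-_; _*_; -_; _^_)
import Data.Integer.Properties as ℤP
open import Data.Integer.Divisibility.Signed
  using ( _∣_; divides; _∣?_; ∣-refl; ∣-trans; ∣ᵤ⇒∣; ∣⇒∣ᵤ
        ; ∣m∣n⇒∣m+n; ∣m+n∣m⇒∣n; ∣m⇒∣-m; ∣n⇒∣m*n; ∣m⇒∣m*n)
open import Data.Integer.Tactic.RingSolver using (solve-∀)
open import Data.List using ([]; _∷_)
open import Data.List.Properties using (≡-dec)
open import Data.List.Relation.Unary.All using (all?; []; _∷_)
open import Data.Nat as ℕ using (ℕ; zero; suc)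
import Data.Nat.Divisibility as ℕD
import Data.Nat.Properties as ℕP
open import Data.Sum using ([_,_]′)
open import Relation.Binary.PropositionalEquality
open import Relation.Nullary using (yes; no; contradiction)
open import Relation.Nullary.Decidable using (True; toWitness; from-no)
import Relation.Binary.Reasoning.Setoid as SetoidReasoning

module _ {a b ℓ₁ ℓ₂ ℓ} {R : RawRing a ℓ₁} {S : RawRing b ℓ₂}
         (_∼_ : RawRing.Carrier R → RawRing.Carrier S → Set ℓ)
         (0∼0 : RawRing.0# R ∼ RawRing.0# S) where

  shiftCoef-cong : ∀ m {x y} → (∀ e → x e ∼ y e) → ∀ i k → shiftCoef R m x i k ∼ shiftCoef S m y i k
  shiftCoef-cong m x∼y i k with i ℕ.≤? k
  ... | no _ = 0∼0
  ... | yes _ with (k ℕ.∸ i) ℕ.≤? m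
  ...   | yes _ = x∼y (m ℕ.∸ (k ℕ.∸ i))
  ...   | no _  = 0∼0

  sylvester-cong : ∀ m n {x x′ y y′} → (∀ e → x e ∼ y e) → (∀ e → x′ e ∼ y′ e) →
                   ∀ i k → sylvester R m n x x′ i k ∼ sylvester S m n y y′ i k
  sylvester-cong m n x∼y x′∼y′ i k with suc (toℕ i) ℕ.≤? n
  ... | yes _ = shiftCoef-cong m x∼y (toℕ i) (toℕ k)
  ... | no _  = shiftCoef-cong n x′∼y′ (toℕ i ℕ.∸ n) (toℕ k)

module _ {a b ℓ₁ ℓ₂} {R : RawRing a ℓ₁} (S : Ring b ℓ₂) where
  private
    module R = RawRing R
    module S = Ring S
  open RingMorphisms R S.rawRing using (IsRingHomomorphism)
  open SetoidReasoning S.setoid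

  module _ {f : R.Carrier → S.Carrier} (f-isRingHomomorphism : IsRingHomomorphism f) where
    open IsRingHomomorphism f-isRingHomomorphism

    altSum-homo : ∀ n {x y} → (∀ k → f (x k) S.≈ y k) → f (altSum R n x) S.≈ altSum S.rawRing n y
    altSum-homo zero                fx≈y = 0#-homo
    altSum-homo (suc n) {x} {y} fx≈y = begin
      f (x fzero R.+ R.- altSum R n (x ∘ fsuc))      ≈⟨ +-homo _ _ ⟩
      f (x fzero) S.+ f (R.- altSum R n (x ∘ fsuc))  ≈⟨ S.+-cong (fx≈y fzero) (-‿homo _) ⟩
      y fzero S.+ S.- f (altSum R n (x ∘ fsuc))      ≈⟨ S.+-congˡ (S.-‿cong (altSum-homo n (fx≈y ∘ fsuc))) ⟩
      y fzero S.+ S.- altSum S.rawRing n (y ∘ fsuc)  ∎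

    det-homo : ∀ n {M N} → (∀ i k → f (M i k) S.≈ N i k) → f (det R n M) S.≈ det S.rawRing n N
    det-homo zero    fM≈N = 1#-homo
    det-homo (suc n) fM≈N = altSum-homo (suc n) λ j →
      S.trans (*-homo _ _) (S.*-cong (fM≈N fzero j) (det-homo n (λ r k → fM≈N (fsuc r) (punchIn j k))))

    resultant-homo : ∀ m n x x′ y y′ → (∀ e → f (x e) S.≈ y e) → (∀ e → f (x′ e) S.≈ y′ e) →
                     f (resultant R m n x x′) S.≈ resultant S.rawRing m n y y′
    resultant-homo m n _ _ _ _ fx≈y fx′≈y′ =
      det-homo (m ℕ.+ n) (sylvester-cong (λ u v → f u S.≈ v) 0#-homo m n fx≈y fx′≈y′)

open ≡-Reasoning

isZeroPoly-byComputation : (p : Poly) → {True (all? (ℤ._≟ 0ℤ) p)} → IsZeroPoly p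
isZeroPoly-byComputation p {w} = toWitness w

polyRawRing : RawRing 0ℓ 0ℓ
polyRawRing = record
  { Carrier = Poly ; _≈_ = _≡_ ; _+_ = _+ₚ_ ; _*_ = _*ₚ_ ; -_ = -ₚ_ ; 0# = [] ; 1# = + 1 ∷ [] }

infixr 8 _^ₚ_

_^ₚ_ : Poly → ℕ → Poly
p ^ₚ zero  = + 1 ∷ []
p ^ₚ suc n = p *ₚ p ^ₚ n

eval : ℤ → Poly → ℤ
eval t []      = 0ℤ
eval t (c ∷ p) = c + t * eval t p

module _ (t : ℤ) where

  eval-+ₚ : ∀ p q → eval t (p +ₚ q) ≡ eval t p + eval t q
  eval-+ₚ []      q       = sym (ℤP.+-identityˡ _)
  eval-+ₚ (c ∷ p) []      = sym (ℤP.+-identityʳ _)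
  eval-+ₚ (c ∷ p) (d ∷ q) = trans (cong (λ e → c + d + t * e) (eval-+ₚ p q)) (regroup c d t _ _)
    where
    regroup : ∀ c d t x y → c + d + t * (x + y) ≡ (c + t * x) + (d + t * y)
    regroup = solve-∀

  eval--ₚ : ∀ p → eval t (-ₚ p) ≡ - eval t p
  eval--ₚ []      = refl
  eval--ₚ (c ∷ p) = trans (cong (λ e → - c + t * e) (eval--ₚ p)) (regroup c t _)
    where
    regroup : ∀ c t x → - c + t * - x ≡ - (c + t * x)
    regroup = solve-∀

  eval-scaleₚ : ∀ a p → eval t (scaleₚ a p) ≡ a * eval t p
  eval-scaleₚ a []      = sym (ℤP.*-zeroʳ a)
  eval-scaleₚ a (c ∷ p) = trans (cong (λ e → a * c + t * e) (eval-scaleₚ a p)) (regroup a c t _)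
    where
    regroup : ∀ a c t x → a * c + t * (a * x) ≡ a * (c + t * x)
    regroup = solve-∀

  eval-*ₚ : ∀ p q → eval t (p *ₚ q) ≡ eval t p * eval t q
  eval-*ₚ []      q = sym (ℤP.*-zeroˡ (eval t q))
  eval-*ₚ (c ∷ p) q = begin
    eval t (scaleₚ c q +ₚ (0ℤ ∷ p *ₚ q))
      ≡⟨ eval-+ₚ (scaleₚ c q) (0ℤ ∷ p *ₚ q) ⟩
    eval t (scaleₚ c q) + (0ℤ + t * eval t (p *ₚ q))
      ≡⟨ cong₂ (λ x y → x + (0ℤ + t * y)) (eval-scaleₚ c q) (eval-*ₚ p q) ⟩
    c * eval t q + (0ℤ + t * (eval t p * eval t q))
      ≡⟨ regroup c t _ _ ⟩
    (c + t * eval t p) * eval t q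
      ∎
    where
    regroup : ∀ c t x y → c * y + (0ℤ + t * (x * y)) ≡ (c + t * x) * y
    regroup = solve-∀

  eval-1 : eval t (+ 1 ∷ []) ≡ + 1
  eval-1 = cong (λ e → 1ℤ + e) (ℤP.*-zeroʳ t)

  eval-^ₚ : ∀ p n → eval t (p ^ₚ n) ≡ eval t p ^ n
  eval-^ₚ p zero    = eval-1
  eval-^ₚ p (suc n) = trans (eval-*ₚ p (p ^ₚ n)) (cong (eval t p *_) (eval-^ₚ p n))

  eval-isRingHomomorphism : RingMorphisms.IsRingHomomorphism polyRawRing ℤ.+-*-rawRing (eval t)
  eval-isRingHomomorphism = record
    { isSemiringHomomorphism = record
      { isNearSemiringHomomorphism = record
        { +-isMonoidHomomorphism = record
          { isMagmaHomomorphism = record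
            { isRelHomomorphism = record { cong = cong (eval t) }
            ; homo = eval-+ₚ
            }
          ; ε-homo = refl
          }
        ; *-homo = eval-*ₚ
        }
      ; 1#-homo = eval-1
      }
    ; -‿homo = eval--ₚ
    }

  isZeroPoly⇒eval≡0 : ∀ {p} → IsZeroPoly p → eval t p ≡ 0ℤ
  isZeroPoly⇒eval≡0 []           = refl
  isZeroPoly⇒eval≡0 (refl ∷ p≡0) =
    trans (cong (λ e → 0ℤ + t * e) (isZeroPoly⇒eval≡0 p≡0)) (cong (λ e → 0ℤ + e) (ℤP.*-zeroʳ t))

  zeroDifference⇒eval≡ : ∀ p q → IsZeroPoly (p +ₚ -ₚ q) → eval t p ≡ eval t q
  zeroDifference⇒eval≡ p q p-q≡0 = ℤP.i-j≡0⇒i≡j _ _ (begin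
    eval t p - eval t q       ≡⟨ cong (λ e → eval t p + e) (eval--ₚ q) ⟨
    eval t p + eval t (-ₚ q)  ≡⟨ eval-+ₚ p (-ₚ q) ⟨
    eval t (p +ₚ -ₚ q)        ≡⟨ isZeroPoly⇒eval≡0 p-q≡0 ⟩
    0ℤ                        ∎)

divisibleByLarge⇒≡0 : (T : ℕ → ℤ) → (∀ n → n ℕ.< ∣ T n ∣) →
                      ∀ {c} → (∀ n → T n ∣ c) → c ≡ 0ℤ
divisibleByLarge⇒≡0 T T-large {c} T∣c with ∣ c ∣ in ∣c∣≡
... | zero  = ℤP.∣i∣≡0⇒i≡0 ∣c∣≡
... | suc m = contradiction (ℕD.∣⇒≤ (subst (∣ T (suc m) ∣ ℕD.∣_) ∣c∣≡ (∣⇒∣ᵤ (T∣c (suc m)))))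
                            (ℕP.<⇒≱ (T-large (suc m)))

vanishing⇒isZeroPoly : (T : ℕ → ℤ) → (∀ n → n ℕ.< ∣ T n ∣) →
                       ∀ p → (∀ n → eval (T n) p ≡ 0ℤ) → IsZeroPoly p
vanishing⇒isZeroPoly T T-large []      _   = []
vanishing⇒isZeroPoly T T-large (c ∷ p) p≡0 = c≡0 ∷ vanishing⇒isZeroPoly T T-large p tail≡0
  where
  solve-for-c : ∀ c t x → c + t * x ≡ 0ℤ → c ≡ - x * t
  solve-for-c c t x c+tx≡0 = begin
    c                     ≡⟨ regroup c t x ⟩
    (c + t * x) + - x * t ≡⟨ cong (λ e → e + - x * t) c+tx≡0 ⟩
    0ℤ + - x * t          ≡⟨ ℤP.+-identityˡ (- x * t) ⟩
    - x * t               ∎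
    where
    regroup : ∀ c t x → c ≡ (c + t * x) + - x * t
    regroup = solve-∀

  c≡0 : c ≡ 0ℤ
  c≡0 = divisibleByLarge⇒≡0 T T-large (λ n → divides (- eval (T n) p) (solve-for-c c (T n) _ (p≡0 n)))

  T≢0 : ∀ n → T n ≢ 0ℤ
  T≢0 n Tn≡0 = ℕP.n≮0 (subst (λ e → n ℕ.< ∣ e ∣) Tn≡0 (T-large n))

  tail≡0 : ∀ n → eval (T n) p ≡ 0ℤ
  tail≡0 n = [ ⊥-elim ∘ T≢0 n , id ]′ (ℤP.i*j≡0⇒i≡0∨j≡0 (T n) (begin
    T n * eval (T n) p       ≡⟨ ℤP.+-identityˡ _ ⟨
    0ℤ + T n * eval (T n) p  ≡⟨ cong (λ e → e + T n * eval (T n) p) c≡0 ⟨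
    c + T n * eval (T n) p   ≡⟨ p≡0 n ⟩
    0ℤ                       ∎))

eval-congruence : ∀ p s t → t - s ∣ eval t p - eval s p
eval-congruence []      s t = divides 0ℤ refl
eval-congruence (c ∷ p) s t =
  subst (t - s ∣_) (sym (regroup c s t (eval s p) (eval t p)))
        (∣m∣n⇒∣m+n (∣n⇒∣m*n t (eval-congruence p s t)) (∣m⇒∣m*n (eval s p) ∣-refl))
  where
  regroup : ∀ c s t x y → (c + t * y) - (c + s * x) ≡ t * (y - x) + (t - s) * x
  regroup = solve-∀

odd : ℕ → ℤ
odd n = + suc (2 ℕ.* n)

n<∣odd∣ : ∀ n → n ℕ.< ∣ odd n ∣
n<∣odd∣ n = ℕ.s≤s (ℕP.m≤n*m n 2)

eval-odd≢0 : ∀ p → ¬ (+ 2 ∣ eval (+ 1) p) → ∀ n → eval (odd n) p ≢ 0ℤ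
eval-odd≢0 p 2∤p[1] n p[t]≡0 = 2∤p[1] (subst (+ 2 ∣_) (ℤP.neg-involutive _) (∣m⇒∣-m 2∣-p[1]))
  where
  2∣p[t] : + 2 ∣ eval (odd n) p
  2∣p[t] = subst (+ 2 ∣_) (sym p[t]≡0) (divides 0ℤ refl)
  2∣-p[1] : + 2 ∣ - eval (+ 1) p
  2∣-p[1] = ∣m+n∣m⇒∣n (∣-trans (∣ᵤ⇒∣ (ℕD.m∣m*n n)) (eval-congruence p (+ 1) (odd n))) 2∣p[t]

-- x(t) = a / d, cross-multiplied so that it is meaningful even where den x or d vanish at t
record EvaluatesTo (t : ℤ) (x : Frac) (a d : ℤ) : Set where
  constructor evaluatesTo
  field crossMultiplied : eval t (num x) * d ≡ a * eval t (den x)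

module _ (t : ℤ) where

  evaluatesTo-0# : ∀ d → EvaluatesTo t (poly []) 0ℤ d
  evaluatesTo-0# d = evaluatesTo refl

  evaluatesTo-1# : EvaluatesTo t (poly (+ 1 ∷ [])) 1ℤ 1ℤ
  evaluatesTo-1# = evaluatesTo (ℤP.*-comm _ 1ℤ)

  evaluatesTo-neg : ∀ {x a d} → EvaluatesTo t x a d → EvaluatesTo t (-f x) (- a) d
  evaluatesTo-neg {x} {a} {d} (evaluatesTo x↦a) = evaluatesTo $ begin
    eval t (-ₚ num x) * d    ≡⟨ cong (_* d) (eval--ₚ t (num x)) ⟩
    - eval t (num x) * d     ≡⟨ ℤP.neg-distribˡ-* (eval t (num x)) d ⟨
    - (eval t (num x) * d)   ≡⟨ cong -_ x↦a ⟩
    - (a * eval t (den x))   ≡⟨ ℤP.neg-distribˡ-* a (eval t (den x)) ⟩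
    - a * eval t (den x)     ∎

  evaluatesTo-* : ∀ {x y a b d e} → EvaluatesTo t x a d → EvaluatesTo t y b e →
                  EvaluatesTo t (x *f y) (a * b) (d * e)
  evaluatesTo-* {x} {y} {a} {b} {d} {e} (evaluatesTo x↦a) (evaluatesTo y↦b) = evaluatesTo $ begin
    eval t (num x *ₚ num y) * (d * e)  ≡⟨ cong (_* (d * e)) (eval-*ₚ t (num x) (num y)) ⟩
    X * Y * (d * e)                    ≡⟨ interchange X Y d e ⟩
    (X * d) * (Y * e)                  ≡⟨ cong₂ _*_ x↦a y↦b ⟩
    (a * Dx) * (b * Dy)                ≡⟨ interchange a b Dx Dy ⟨
    a * b * (Dx * Dy)                  ≡⟨ cong (a * b *_) (eval-*ₚ t (den x) (den y)) ⟨
    a * b * eval t (den x *ₚ den y)    ∎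
    where
    X = eval t (num x); Y = eval t (num y); Dx = eval t (den x); Dy = eval t (den y)
    interchange : ∀ p q u w → p * q * (u * w) ≡ (p * u) * (q * w)
    interchange = solve-∀

  evaluatesTo-+ : ∀ {x y a b d} → EvaluatesTo t x a d → EvaluatesTo t y b d →
                  EvaluatesTo t (x +f y) (a + b) d
  evaluatesTo-+ {x} {y} {a} {b} {d} (evaluatesTo x↦a) (evaluatesTo y↦b) with ≡-dec ℤ._≟_ (den x) (den y)
  ... | yes dx≡dy = evaluatesTo $ begin
    eval t (num x +ₚ num y) * d  ≡⟨ cong (_* d) (eval-+ₚ t (num x) (num y)) ⟩
    (X + Y) * d                  ≡⟨ ℤP.*-distribʳ-+ d X Y ⟩
    X * d + Y * d                ≡⟨ cong₂ _+_ x↦a (trans y↦b (cong (λ q → b * eval t q) (sym dx≡dy))) ⟩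
    a * Dx + b * Dx              ≡⟨ ℤP.*-distribʳ-+ Dx a b ⟨
    (a + b) * Dx                 ∎
    where
    X = eval t (num x); Y = eval t (num y); Dx = eval t (den x)
  ... | no _ = evaluatesTo $ begin
    eval t (num x *ₚ den y +ₚ num y *ₚ den x) * d  ≡⟨ cong (_* d) eval-sum ⟩
    (X * Dy + Y * Dx) * d                          ≡⟨ regroup₁ X Y Dx Dy d ⟩
    (X * d) * Dy + (Y * d) * Dx                    ≡⟨ cong₂ (λ u w → u * Dy + w * Dx) x↦a y↦b ⟩
    (a * Dx) * Dy + (b * Dy) * Dx                  ≡⟨ regroup₂ a b Dx Dy ⟩
    (a + b) * (Dx * Dy)                            ≡⟨ cong ((a + b) *_) (eval-*ₚ t (den x) (den y)) ⟨
    (a + b) * eval t (den x *ₚ den y)              ∎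
    where
    X = eval t (num x); Y = eval t (num y); Dx = eval t (den x); Dy = eval t (den y)
    eval-sum : eval t (num x *ₚ den y +ₚ num y *ₚ den x) ≡ X * Dy + Y * Dx
    eval-sum = trans (eval-+ₚ t (num x *ₚ den y) (num y *ₚ den x))
                     (cong₂ _+_ (eval-*ₚ t (num x) (den y)) (eval-*ₚ t (num y) (den x)))
    regroup₁ : ∀ X Y Dx Dy d → (X * Dy + Y * Dx) * d ≡ (X * d) * Dy + (Y * d) * Dx
    regroup₁ = solve-∀
    regroup₂ : ∀ a b Dx Dy → (a * Dx) * Dy + (b * Dy) * Dx ≡ (a + b) * (Dx * Dy)
    regroup₂ = solve-∀

  evaluatesTo-altSum : ∀ n {x a d} → (∀ k → EvaluatesTo t (x k) (a k) d) →
                       EvaluatesTo t (altSum ℚ⟨v⟩ n x) (altSum ℤ.+-*-rawRing n a) d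
  evaluatesTo-altSum zero    {d = d} _   = evaluatesTo-0# d
  evaluatesTo-altSum (suc n) x↦a =
    evaluatesTo-+ (x↦a fzero) (evaluatesTo-neg (evaluatesTo-altSum n (x↦a ∘ fsuc)))

  evaluatesTo-det : ∀ n {M A d} → (∀ i k → EvaluatesTo t (M i k) (A i k) d) →
                    EvaluatesTo t (det ℚ⟨v⟩ n M) (det ℤ.+-*-rawRing n A) (d ^ n)
  evaluatesTo-det zero    _   = evaluatesTo-1#
  evaluatesTo-det (suc n) M↦A = evaluatesTo-altSum (suc n) λ j →
    evaluatesTo-* (M↦A fzero j) (evaluatesTo-det n (λ r k → M↦A (fsuc r) (punchIn j k)))

  evaluatesTo-resultant : ∀ m n x x′ a a′ d →
                          (∀ e → EvaluatesTo t (x e) (a e) d) → (∀ e → EvaluatesTo t (x′ e) (a′ e) d) →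
                          EvaluatesTo t (resultant ℚ⟨v⟩ m n x x′) (resultant ℤ.+-*-rawRing m n a a′)
                                      (d ^ (m ℕ.+ n))
  evaluatesTo-resultant m n _ _ _ _ d x↦a x′↦a′ = evaluatesTo-det (m ℕ.+ n)
    (sylvester-cong (λ y b → EvaluatesTo t y b d) (evaluatesTo-0# d) m n x↦a x′↦a′)

  ≈f⇒evaluatesTo : ∀ {x} p q → x ≈f (p /ₚ q) → EvaluatesTo t x (eval t p) (eval t q)
  ≈f⇒evaluatesTo {x} p q x≈p/q = evaluatesTo $ begin
    eval t (num x) * eval t q  ≡⟨ eval-*ₚ t (num x) q ⟨
    eval t (num x *ₚ q)        ≡⟨ zeroDifference⇒eval≡ t (num x *ₚ q) (p *ₚ den x) x≈p/q ⟩
    eval t (p *ₚ den x)        ≡⟨ eval-*ₚ t p (den x) ⟩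
    eval t p * eval t (den x)  ∎

  crossDifference-vanishes : ∀ {x y a d} → d ≢ 0ℤ → EvaluatesTo t x a d → EvaluatesTo t y a d →
                             eval t (num x *ₚ den y +ₚ -ₚ (num y *ₚ den x)) ≡ 0ℤ
  crossDifference-vanishes {x} {y} {a} {d} d≢0 (evaluatesTo x↦a) (evaluatesTo y↦a) =
    [ id , ⊥-elim ∘ d≢0 ]′ (ℤP.i*j≡0⇒i≡0∨j≡0 _ (begin
      eval t (num x *ₚ den y +ₚ -ₚ (num y *ₚ den x)) * d  ≡⟨ cong (_* d) eval-difference ⟩
      (X * Dy - Y * Dx) * d                              ≡⟨ regroup X Y Dx Dy d ⟩
      (X * d) * Dy - (Y * d) * Dx                        ≡⟨ cong₂ (λ u w → u * Dy - w * Dx) x↦a y↦a ⟩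
      (a * Dx) * Dy - (a * Dy) * Dx                      ≡⟨ cancel a Dx Dy ⟩
      0ℤ                                                 ∎))
    where
    X = eval t (num x); Y = eval t (num y); Dx = eval t (den x); Dy = eval t (den y)
    eval-difference : eval t (num x *ₚ den y +ₚ -ₚ (num y *ₚ den x)) ≡ X * Dy - Y * Dx
    eval-difference = trans (eval-+ₚ t (num x *ₚ den y) (-ₚ (num y *ₚ den x)))
      (cong₂ _+_ (eval-*ₚ t (num x) (den y))
                 (trans (eval--ₚ t (num y *ₚ den x)) (cong -_ (eval-*ₚ t (num y) (den x)))))
    regroup : ∀ X Y Dx Dy d → (X * Dy - Y * Dx) * d ≡ (X * d) * Dy - (Y * d) * Dx
    regroup = solve-∀
    cancel : ∀ a Dx Dy → (a * Dx) * Dy - (a * Dy) * Dx ≡ 0ℤ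
    cancel = solve-∀

≈f-byEvaluation : ∀ x y (T : ℕ → ℤ) → (∀ n → n ℕ.< ∣ T n ∣) →
                  (a d : ℤ → ℤ) → (∀ n → d (T n) ≢ 0ℤ) →
                  (∀ t → EvaluatesTo t x (a t) (d t)) → (∀ t → EvaluatesTo t y (a t) (d t)) →
                  x ≈f y
≈f-byEvaluation x y T T-large a d d≢0 x↦a y↦a = vanishing⇒isZeroPoly T T-large _ λ n →
  crossDifference-vanishes (T n) (d≢0 n) (x↦a (T n)) (y↦a (T n))

A³ : Poly
A³ = Aₚ *ₚ Aₚ *ₚ Aₚ

-- coefficients of F(X) = A(v)³ f(X)
Fcoef : ℕ → Poly
Fcoef 0 = constₚ -[1+ 1 ] *ₚ num j *ₚ Aₚ
Fcoef 1 = constₚ -[1+ 2 ] *ₚ num j *ₚ Aₚ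
Fcoef 3 = A³
Fcoef _ = []

fcoef≈Fcoef/A³ : ∀ e → fcoef e ≈f (Fcoef e /ₚ A³)
fcoef≈Fcoef/A³ 0 = isZeroPoly-byComputation _
fcoef≈Fcoef/A³ 1 = isZeroPoly-byComputation _
fcoef≈Fcoef/A³ 2 = isZeroPoly-byComputation _
fcoef≈Fcoef/A³ 3 = isZeroPoly-byComputation _
fcoef≈Fcoef/A³ (suc (suc (suc (suc _)))) = []

ResGF : Poly
ResGF = constₚ (-[1+ 2 ] * (+ 72) ^ 4) *ₚ num j ^ₚ 3 *ₚ Aₚ ^ₚ 9

resultant-Gcoef-Fcoef : IsZeroPoly (resultant polyRawRing 3 3 Gcoef Fcoef +ₚ -ₚ ResGF)
resultant-Gcoef-Fcoef = isZeroPoly-byComputation _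

S : Frac
S = (constₚ ((+ 72) ^ 2) *ₚ num j) /ₚ (Aₚ ^ₚ 5)

-3jvAS²≈ResGF/A¹⁸ : poly (constₚ -[1+ 2 ]) *f j *f poly vₚ *f poly Aₚ *f S *f S
                    ≈f (ResGF /ₚ (A³ ^ₚ 6))
-3jvAS²≈ResGF/A¹⁸ = isZeroPoly-byComputation _

resultant-evaluatesTo : ∀ t →
  EvaluatesTo t (resultant ℚ⟨v⟩ 3 3 gcoef fcoef) (eval t ResGF) (eval t (A³ ^ₚ 6))
resultant-evaluatesTo t = subst₂ (EvaluatesTo t _) integer-resultant (sym (eval-^ₚ t A³ 6))
  (evaluatesTo-resultant t 3 3 gcoef fcoef (eval t ∘ Gcoef) (eval t ∘ Fcoef) (eval t A³)
    (λ _ → evaluatesTo refl) (λ e → ≈f⇒evaluatesTo t (Fcoef e) A³ (fcoef≈Fcoef/A³ e)))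
  where
  integer-resultant : resultant ℤ.+-*-rawRing 3 3 (eval t ∘ Gcoef) (eval t ∘ Fcoef) ≡ eval t ResGF
  integer-resultant = begin
    resultant ℤ.+-*-rawRing 3 3 (eval t ∘ Gcoef) (eval t ∘ Fcoef)
      ≡⟨ resultant-homo ℤP.+-*-ring (eval-isRingHomomorphism t) 3 3 Gcoef Fcoef _ _
                        (λ _ → refl) (λ _ → refl) ⟨
    eval t (resultant polyRawRing 3 3 Gcoef Fcoef)
      ≡⟨ zeroDifference⇒eval≡ t (resultant polyRawRing 3 3 Gcoef Fcoef) ResGF resultant-Gcoef-Fcoef ⟩
    eval t ResGF
      ∎

resultant≈-3jvAS² : resultant ℚ⟨v⟩ 3 3 gcoef fcoef
                    ≈f (poly (constₚ -[1+ 2 ]) *f j *f poly vₚ *f poly Aₚ *f S *f S)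
resultant≈-3jvAS² =
  ≈f-byEvaluation (resultant ℚ⟨v⟩ 3 3 gcoef fcoef)
                  (poly (constₚ -[1+ 2 ]) *f j *f poly vₚ *f poly Aₚ *f S *f S) odd n<∣odd∣
    (λ t → eval t ResGF) (λ t → eval t (A³ ^ₚ 6)) A¹⁸≢0-at-odd
    resultant-evaluatesTo (λ t → ≈f⇒evaluatesTo t ResGF (A³ ^ₚ 6) -3jvAS²≈ResGF/A¹⁸)
  where
  A¹⁸≢0-at-odd : ∀ n → eval (odd n) (A³ ^ₚ 6) ≢ 0ℤ
  A¹⁸≢0-at-odd = eval-odd≢0 (A³ ^ₚ 6) (from-no (+ 2 ∣? eval (+ 1) (A³ ^ₚ 6)))

lemma7p1 : Σ Frac (λ S → (¬ IsZeroPoly (den S)) ×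
    (resultant ℚ⟨v⟩ 3 3 gcoef fcoef
    ≈f (poly (constₚ -[1+ 2 ]) *f j *f poly vₚ *f poly Aₚ *f S *f S)))
lemma7p1 = S , (λ { (() ∷ _) }) , resultant≈-3jvAS²
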